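{- Let $n\ge2$ and let $L(F_n)$ be the line graph of the friendship graph $F_n$, with maximum degree $\Delta$. Then $\chi_r(L(F_n))=2n$ if $r<\Delta$, and $\chi_r(L(F_n))=2n+1$ if $r=\Delta$.
   Context: The friendship graph $F_n$ is the windmill graph $Wd(3,n)$: $n$ triangles sharing one common center vertex. All graphs are simple, connected and undirected; $N_G(v)$ is the open neighborhood, $d(v)=|N_G(v)|$, $\Delta$ the maximum degree. For a coloring $c$ and vertex set $S$, $c(S)=\{c(u):u\in S\}$. For integers $k>0$ and $0<r\le\Delta(G)$ with $r\le k$, a conditional $(k,r)$-coloring of $G$ is a surjective map $c:V(G)\to\{1,\dots,k\}$ such that (C1) $c(u)\ne c(v)$ whenever $uv\in E(G)$, and (C2) $|c(N_G(v))|\ge\min\{d(v),r\}$ for every vertex $v$. $\chi_r(G)$ is the smallest $k$ for which $G$ has a conditional $(k,r)$-coloring. -}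

module Defs where

open import Data.Nat using (ℕ; zero; suc; _+_; _≤_; _<_; _⊔_; _⊓_)
open import Data.Bool using (Bool; true; false; if_then_else_; _∧_; _∨_; not)
open import Data.Fin using (Fin; zero; suc; _↑ˡ_; _↑ʳ_; _≟_)
open import Data.List using (List; []; _∷_; length; lookup; concatMap; allFin)
open import Data.Product using (_×_; _,_; Σ; ∃)
open import Relation.Nullary.Decidable using (⌊_⌋)
open import Relation.Binary.PropositionalEquality using (_≡_)
open import Relation.Nullary using (¬_)

_==_ : ∀ {m} → Fin m → Fin m → Bool
i == j = ⌊ i ≟ j ⌋

countF : ∀ {m} → (Fin m → Bool) → ℕ
countF {zero} p = 0
countF {suc m} p = (if p zero then 1 else 0) + countF (λ i → p (suc i))

anyF : ∀ {m} → (Fin m → Bool) → Bool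
anyF {zero} p = false
anyF {suc m} p = p zero ∨ anyF (λ i → p (suc i))

maxF : ∀ {m} → (Fin m → ℕ) → ℕ
maxF {zero} f = 0
maxF {suc m} f = f zero ⊔ maxF (λ i → f (suc i))

record Graph : Set where
  field
    V   : ℕ
    adj : Fin V → Fin V → Bool
open Graph public

deg : (G : Graph) → Fin (V G) → ℕ
deg G v = countF (λ u → adj G v u)

maxDeg : Graph → ℕ
maxDeg G = maxF (deg G)

nbrColours : (G : Graph) {k : ℕ} → (Fin (V G) → Fin k) → Fin (V G) → ℕ
nbrColours G c v = countF (λ j → anyF (λ u → adj G v u ∧ (c u == j)))

edgeGraph : (m : ℕ) → List (Fin m × Fin m) → Graph
edgeGraph m es = record
  { V = m
  ; adj = λ u v → anyF (λ e → ((proj₁' (lookup es e) == u) ∧ (proj₂' (lookup es e) == v))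
                            ∨ ((proj₁' (lookup es e) == v) ∧ (proj₂' (lookup es e) == u))) }
  where
  proj₁' : ∀ {A : Set} → A × A → A
  proj₁' (a , _) = a
  proj₂' : ∀ {A : Set} → A × A → A
  proj₂' (_ , b) = b

shareEnd : ∀ {m} → Fin m × Fin m → Fin m × Fin m → Bool
shareEnd (a , b) (c , d) = (a == c) ∨ (a == d) ∨ (b == c) ∨ (b == d)

-- line graph of the graph on Fin m with (distinct) edge list es:
-- vertices are the edges, two distinct edges adjacent iff they share an endpoint
lineGraph : (m : ℕ) → List (Fin m × Fin m) → Graph
lineGraph m es = record
  { V = length es
  ; adj = λ e f → not (e == f) ∧ shareEnd (lookup es e) (lookup es f) }

-- Friendship graph F_n on Fin (1 + (n + n)): centre = zero,
-- triangle i has outer vertices a i = suc (i ↑ˡ n), b i = suc (n ↑ʳ i).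
friendshipEdges : (n : ℕ) → List (Fin (suc (n + n)) × Fin (suc (n + n)))
friendshipEdges n = concatMap tri (allFin n)
  where
  tri : Fin n → List (Fin (suc (n + n)) × Fin (suc (n + n)))
  tri i = (zero , a) ∷ (zero , b) ∷ (a , b) ∷ []
    where
    a = suc (i ↑ˡ n)
    b = suc (n ↑ʳ i)

friendship : ℕ → Graph
friendship n = edgeGraph (suc (n + n)) (friendshipEdges n)

lineFriendship : ℕ → Graph
lineFriendship n = lineGraph (suc (n + n)) (friendshipEdges n)

record CondColouring (G : Graph) (k r : ℕ) : Set where
  field
    k-pos   : 0 < k
    r-pos   : 0 < r
    r≤Δ     : r ≤ maxDeg G
    r≤k     : r ≤ k
    colour  : Fin (V G) → Fin k
    surj    : ∀ (j : Fin k) → ∃ λ v → colour v ≡ j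
    proper  : ∀ u v → adj G u v ≡ true → ¬ (colour u ≡ colour v)
    cond    : ∀ v → (deg G v ⊓ r) ≤ nbrColours G colour v

IsChiR : Graph → ℕ → ℕ → Set
IsChiR G r k = CondColouring G k r × (∀ k′ → k′ < k → ¬ CondColouring G k′ r)

-- In L(Fₙ) the 2n spokes (the edges at the centre of Fₙ) form a clique, each spoke is
-- also adjacent to the rim of its own triangle, and a rim is adjacent only to its two
-- spokes; so Δ = 2n, attained at the spokes, and the clique forces 2n colours. For
-- r < Δ, colour the spokes bijectively with 2n colours and give each rim the colour of
-- a spoke of another triangle: a spoke then sees the 2n − 1 ≥ r other spoke colours and
-- a rim sees two colours. For r = Δ a spoke must see 2n colours besides its own, so
-- 2n + 1 colours are needed, and giving all rims one extra colour suffices.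

module Submission where

open import Defs
open import Data.Bool using (Bool; true; false; if_then_else_; _∧_; _∨_; not)
open import Data.Bool.Properties using (∨-zeroʳ)
open import Data.Fin using (Fin; zero; suc; _↑ˡ_; _↑ʳ_; _≟_; splitAt; join)
import Data.Fin.Properties as Finₚ
open import Data.Fin.Properties using (suc-injective; ↑ˡ-injective; ↑ʳ-injective; splitAt-↑ˡ; splitAt-↑ʳ; join-splitAt; pigeonhole)
open import Data.List using (List; []; _∷_; length; lookup; concatMap; tabulate)
open import Data.Nat using (ℕ; zero; suc; _+_; _*_; _≤_; _<_; _⊓_; z≤n; s≤s; z<s)
open import Data.Nat.Properties hiding (_≟_; suc-injective)
open import Data.Product using (_×_; _,_; proj₁; proj₂; ∃; uncurry)
open import Data.Sum using ([_,_]; [_,_]′)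
open import Function using (_∘_; id; case_of_)
open import Relation.Binary.PropositionalEquality using (_≡_; _≢_; refl; sym; trans; cong; cong₂; subst; module ≡-Reasoning)
open import Relation.Nullary using (yes; no; contradiction)
open import Relation.Binary.Definitions using (DecidableEquality)
open import Relation.Nullary.Decidable using (⌊_⌋; isYes≗does; dec-true; dec-false)

==-refl : ∀ {m} (i : Fin m) → (i == i) ≡ true
==-refl i = trans (isYes≗does (i ≟ i)) (dec-true (i ≟ i) refl)

==-≢ : ∀ {m} {i j : Fin m} → i ≢ j → (i == j) ≡ false
==-≢ {i = i} {j} i≢j = trans (isYes≗does (i ≟ j)) (dec-false (i ≟ j) i≢j)

==⇒≡ : ∀ {m} {i j : Fin m} → (i == j) ≡ true → i ≡ j
==⇒≡ {i = i} {j} h with i ≟ j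
... | yes i≡j = i≡j
==⇒≡ () | no _

≢⇒not-== : ∀ {m} {i j : Fin m} → i ≢ j → not (i == j) ≡ true
≢⇒not-== i≢j = cong not (==-≢ i≢j)

not-==⇒≢ : ∀ {m} {i j : Fin m} → not (i == j) ≡ true → i ≢ j
not-==⇒≢ {i = i} h refl rewrite ==-refl i = case h of λ ()

==-injective : ∀ {a b} {f : Fin a → Fin b} → (∀ {x y} → f x ≡ f y → x ≡ y)
  → ∀ x y → (f x == f y) ≡ (x == y)
==-injective f-inj x y with x ≟ y
... | yes refl = ==-refl _
... | no x≢y = ==-≢ (x≢y ∘ f-inj)

⟦_⟧ : Bool → ℕ
⟦ b ⟧ = if b then 1 else 0

countF-true : ∀ m → countF {m} (λ _ → true) ≡ m
countF-true zero = refl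
countF-true (suc m) = cong suc (countF-true m)

countF-cong : ∀ {m} {p q : Fin m → Bool} → (∀ x → p x ≡ q x) → countF p ≡ countF q
countF-cong {zero} p≡q = refl
countF-cong {suc m} p≡q = cong₂ _+_ (cong ⟦_⟧ (p≡q zero)) (countF-cong (p≡q ∘ suc))

countF-mono : ∀ {m} (p q : Fin m → Bool) → (∀ x → p x ≡ true → q x ≡ true) → countF p ≤ countF q
countF-mono {zero} p q p⇒q = z≤n
countF-mono {suc m} p q p⇒q with p zero in p₀ | q zero in q₀
... | true  | true  = s≤s (countF-mono (p ∘ suc) (q ∘ suc) (p⇒q ∘ suc))
... | true  | false with () ← trans (sym (p⇒q zero p₀)) q₀
... | false | true  = m≤n⇒m≤1+n (countF-mono (p ∘ suc) (q ∘ suc) (p⇒q ∘ suc))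
... | false | false = countF-mono (p ∘ suc) (q ∘ suc) (p⇒q ∘ suc)

countF-≥1 : ∀ {m} (p : Fin m → Bool) {a} → p a ≡ true → 1 ≤ countF p
countF-≥1 p {zero} pa rewrite pa = s≤s z≤n
countF-≥1 p {suc a} pa = ≤-trans (countF-≥1 (p ∘ suc) pa) (m≤n+m _ _)

countF-≥2 : ∀ {m} (p : Fin m → Bool) {a b} → a ≢ b → p a ≡ true → p b ≡ true → 2 ≤ countF p
countF-≥2 p {zero}  {zero}  a≢b _  _  = contradiction refl a≢b
countF-≥2 p {zero}  {suc b} _   pa pb rewrite pa = s≤s (countF-≥1 (p ∘ suc) pb)
countF-≥2 p {suc a} {zero}  _   pa pb rewrite pb = s≤s (countF-≥1 (p ∘ suc) pa)
countF-≥2 p {suc a} {suc b} a≢b pa pb =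
  ≤-trans (countF-≥2 (p ∘ suc) (a≢b ∘ cong suc) pa pb) (m≤n+m _ _)

countF-≢ : ∀ {m} (a : Fin m) → suc (countF (λ x → not (x == a))) ≡ m
countF-≢ {suc m} zero = cong suc (countF-true m)
countF-≢ {suc m} (suc a) =
  cong suc (trans (cong suc (countF-cong (λ x → cong not (==-injective suc-injective x a)))) (countF-≢ a))

anyF-intro : ∀ {m} (p : Fin m → Bool) (a : Fin m) → p a ≡ true → anyF p ≡ true
anyF-intro p zero pa rewrite pa = refl
anyF-intro p (suc a) pa rewrite anyF-intro (p ∘ suc) a pa = ∨-zeroʳ (p zero)

anyF-elim : ∀ {m} (p : Fin m → Bool) → anyF p ≡ true → ∃ λ a → p a ≡ true
anyF-elim {suc m} p h with p zero in p₀
... | true = zero , p₀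
... | false with a , pa ← anyF-elim (p ∘ suc) h = suc a , pa

sumF : ∀ {m} → (Fin m → ℕ) → ℕ
sumF {zero} g = 0
sumF {suc m} g = g zero + sumF (g ∘ suc)

sumF-cong : ∀ {m} {g h : Fin m → ℕ} → (∀ j → g j ≡ h j) → sumF g ≡ sumF h
sumF-cong {zero} g≡h = refl
sumF-cong {suc m} g≡h = cong₂ _+_ (g≡h zero) (sumF-cong (g≡h ∘ suc))

sumF-const : ∀ m c → sumF {m} (λ _ → c) ≡ m * c
sumF-const zero c = refl
sumF-const (suc m) c = cong (c +_) (sumF-const m c)

sumF-δ : ∀ {m} (i : Fin m) c → sumF (λ j → if i == j then c else 0) ≡ c
sumF-δ {suc m} zero c = trans (cong (c +_) (trans (sumF-const m 0) (*-zeroʳ m))) (+-identityʳ c)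
sumF-δ {suc m} (suc i) c =
  trans (sumF-cong (λ j → cong (if_then c else 0) (==-injective suc-injective i j))) (sumF-δ i c)

maxF-≤ : ∀ {m} (f : Fin m → ℕ) (a : Fin m) → f a ≤ maxF f
maxF-≤ f zero = m≤m⊔n _ _
maxF-≤ f (suc a) = ≤-trans (maxF-≤ (f ∘ suc) a) (m≤n⊔m _ _)

maxF-lub : ∀ {m} (f : Fin m → ℕ) {M} → (∀ x → f x ≤ M) → maxF f ≤ M
maxF-lub {zero} f _ = z≤n
maxF-lub {suc m} f f≤M = ⊔-lub (f≤M zero) (maxF-lub (f ∘ suc) (f≤M ∘ suc))

maxF-attained : ∀ {m} (f : Fin m → ℕ) {M} (a : Fin m) → (∀ x → f x ≤ M) → f a ≡ M → maxF f ≡ M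
maxF-attained f a f≤M fa≡M = ≤-antisym (maxF-lub f f≤M) (subst (_≤ maxF f) fa≡M (maxF-≤ f a))

NbrColour : (G : Graph) {k : ℕ} → (Fin (V G) → Fin k) → Fin (V G) → Fin k → Set
NbrColour G c v j = ∃ λ u → adj G v u ≡ true × c u ≡ j

Proper : (G : Graph) {k : ℕ} → (Fin (V G) → Fin k) → Set
Proper G c = ∀ u v → adj G u v ≡ true → c u ≢ c v

module _ (G : Graph) {k : ℕ} (c : Fin (V G) → Fin k) where

  private
    seen : Fin (V G) → Fin k → Bool
    seen v j = anyF (λ u → adj G v u ∧ (c u == j))

    nbrColour⇒seen : ∀ {v j} → NbrColour G c v j → seen v j ≡ true
    nbrColour⇒seen (u , vu , refl) = anyF-intro _ u (cong₂ _∧_ vu (==-refl (c u)))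

    seen⇒nbrColour : ∀ {v j} → seen v j ≡ true → NbrColour G c v j
    seen⇒nbrColour {v} h with u , vu∧cu==j ← anyF-elim _ h with adj G v u in vu
    ... | true = u , vu , ==⇒≡ vu∧cu==j

  nbrColours<k : Proper G c → ∀ v → nbrColours G c v < k
  nbrColours<k proper v =
    ≤-trans (s≤s (countF-mono _ _ own-colour-unseen)) (≤-reflexive (countF-≢ (c v)))
    where
    own-colour-unseen : ∀ j → seen v j ≡ true → not (j == c v) ≡ true
    own-colour-unseen j h with u , vu , refl ← seen⇒nbrColour h = ≢⇒not-== (proper v u vu ∘ sym)

  k≤1+nbrColours : ∀ v → (∀ j → j ≢ c v → NbrColour G c v j) → k ≤ suc (nbrColours G c v)
  k≤1+nbrColours v sees-others = ≤-trans (≤-reflexive (sym (countF-≢ (c v))))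
    (s≤s (countF-mono _ _ (λ j j≢cv → nbrColour⇒seen (sees-others j (not-==⇒≢ j≢cv)))))

  2≤nbrColours : ∀ {v j j′} → j ≢ j′ → NbrColour G c v j → NbrColour G c v j′ → 2 ≤ nbrColours G c v
  2≤nbrColours j≢j′ seen-j seen-j′ = countF-≥2 _ j≢j′ (nbrColour⇒seen seen-j) (nbrColour⇒seen seen-j′)

  clique-size≤k : Proper G c → ∀ {m} (f : Fin m → Fin (V G))
    → (∀ x y → x ≢ y → adj G (f x) (f y) ≡ true) → m ≤ k
  clique-size≤k proper f clique = ≮⇒≥ λ k<m →
    let x , y , x<y , cfx≡cfy = pigeonhole k<m (c ∘ f)
    in proper _ _ (clique x y (Finₚ.<⇒≢ x<y)) cfx≡cfy

deg⊓r<k : ∀ {G k r} (C : CondColouring G k r) v → deg G v ⊓ r < k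
deg⊓r<k {G} C v = ≤-<-trans (cond v) (nbrColours<k G colour proper v)
  where open CondColouring C

data Side : Set where
  spokeˡ spokeʳ rim : Side

_≟ˢ_ : DecidableEquality Side
spokeˡ ≟ˢ spokeˡ = yes refl
spokeʳ ≟ˢ spokeʳ = yes refl
rim    ≟ˢ rim    = yes refl
spokeˡ ≟ˢ spokeʳ = no λ ()
spokeˡ ≟ˢ rim    = no λ ()
spokeʳ ≟ˢ spokeˡ = no λ ()
spokeʳ ≟ˢ rim    = no λ ()
rim    ≟ˢ spokeˡ = no λ ()
rim    ≟ˢ spokeʳ = no λ ()

sameSide : Side → Side → Bool
sameSide s t = ⌊ s ≟ˢ t ⌋

countSide : (Side → Bool) → ℕ
countSide p = ⟦ p spokeˡ ⟧ + (⟦ p spokeʳ ⟧ + ⟦ p rim ⟧)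

module Blocks {X B : Set} (T : X → Side → B) where

  block : X → List B
  block x = T x spokeˡ ∷ T x spokeʳ ∷ T x rim ∷ []

  blocks : ∀ {m} → (Fin m → X) → List B
  blocks f = concatMap block (tabulate f)

  position : ∀ {m} (f : Fin m → X) → Fin m → Side → Fin (length (blocks f))
  position {suc m} f zero spokeˡ = zero
  position {suc m} f zero spokeʳ = suc zero
  position {suc m} f zero rim = suc (suc zero)
  position {suc m} f (suc j) s = suc (suc (suc (position (f ∘ suc) j s)))

  locate : ∀ {m} (f : Fin m → X) → Fin (length (blocks f)) → Fin m × Side
  locate {suc m} f zero = zero , spokeˡ
  locate {suc m} f (suc zero) = zero , spokeʳ
  locate {suc m} f (suc (suc zero)) = zero , rim
  locate {suc m} f (suc (suc (suc v))) with j , s ← locate (f ∘ suc) v = suc j , s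

  position-locate : ∀ {m} (f : Fin m → X) v → uncurry (position f) (locate f v) ≡ v
  position-locate {suc m} f zero = refl
  position-locate {suc m} f (suc zero) = refl
  position-locate {suc m} f (suc (suc zero)) = refl
  position-locate {suc m} f (suc (suc (suc v))) = cong (λ w → suc (suc (suc w))) (position-locate (f ∘ suc) v)

  locate-position : ∀ {m} (f : Fin m → X) j s → locate f (position f j s) ≡ (j , s)
  locate-position {suc m} f zero spokeˡ = refl
  locate-position {suc m} f zero spokeʳ = refl
  locate-position {suc m} f zero rim = refl
  locate-position {suc m} f (suc j) s rewrite locate-position (f ∘ suc) j s = refl

  lookup-position : ∀ {m} (f : Fin m → X) j s → lookup (blocks f) (position f j s) ≡ T (f j) s
  lookup-position {suc m} f zero spokeˡ = refl
  lookup-position {suc m} f zero spokeʳ = refl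
  lookup-position {suc m} f zero rim = refl
  lookup-position {suc m} f (suc j) s = lookup-position (f ∘ suc) j s

  position-injective : ∀ {m} (f : Fin m → X) {i s j t} → position f i s ≡ position f j t → (i , s) ≡ (j , t)
  position-injective f {i} {s} {j} {t} e =
    trans (sym (locate-position f i s)) (trans (cong (locate f) e) (locate-position f j t))

  position-== : ∀ {m} (f : Fin m → X) i s j t → (position f i s == position f j t) ≡ (sameSide s t ∧ (i == j))
  position-== f i s j t with s ≟ˢ t | i ≟ j
  ... | yes refl | yes refl = ==-refl _
  ... | yes refl | no i≢j = ==-≢ (i≢j ∘ cong proj₁ ∘ position-injective f)
  ... | no s≢t   | _      = ==-≢ (s≢t ∘ cong proj₂ ∘ position-injective f)

  position-induction : ∀ {m} (f : Fin m → X) (P : Fin (length (blocks f)) → Set)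
    → (∀ j s → P (position f j s)) → ∀ v → P v
  position-induction f P h v = subst P (position-locate f v) (h _ _)

  countF-blocks : ∀ {m} (f : Fin m → X) (p : Fin (length (blocks f)) → Bool)
    → countF p ≡ sumF (λ j → countSide (p ∘ position f j))
  countF-blocks {zero} f p = refl
  countF-blocks {suc m} f p = begin
    a + (b + (c + countF (λ v → p (suc (suc (suc v))))))
      ≡⟨ cong (λ rest → a + (b + (c + rest))) (countF-blocks (f ∘ suc) (λ v → p (suc (suc (suc v))))) ⟩
    a + (b + (c + rest))   ≡⟨ cong (a +_) (+-assoc b c rest) ⟨
    a + ((b + c) + rest)   ≡⟨ +-assoc a (b + c) rest ⟨
    (a + (b + c)) + rest   ∎
    where
    open ≡-Reasoning
    a = ⟦ p zero ⟧
    b = ⟦ p (suc zero) ⟧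
    c = ⟦ p (suc (suc zero)) ⟧
    rest = sumF (λ j → countSide (p ∘ position f (suc j)))

data Corner : Set where
  centre outerˡ outerʳ : Corner

ends : Side → Corner × Corner
ends spokeˡ = centre , outerˡ
ends spokeʳ = centre , outerʳ
ends rim = outerˡ , outerʳ

-- Corners of triangles i and j; the flag records whether i = j.
sameCorner : Bool → Corner → Corner → Bool
sameCorner _ centre centre = true
sameCorner same outerˡ outerˡ = same
sameCorner same outerʳ outerʳ = same
sameCorner _ _ _ = false

-- Adjacency in L(Fₙ) of side s of triangle i and side t of triangle j, where same = (i == j):
-- the definition of lineGraph with equality of endpoints decided corner by corner.
adjᴸ : Bool → Side → Side → Bool
adjᴸ same s t = not (sameSide s t ∧ same) ∧ meet (ends s) (ends t)
  where
  meet : Corner × Corner → Corner × Corner → Bool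
  meet (c , c′) (d , d′) = sameCorner same c d ∨ sameCorner same c d′ ∨ sameCorner same c′ d ∨ sameCorner same c′ d′

module LineFriendship (n : ℕ) where

  corner : Fin n → Corner → Fin (suc (n + n))
  corner i centre = zero
  corner i outerˡ = suc (i ↑ˡ n)
  corner i outerʳ = suc (n ↑ʳ i)

  triangleEdge : Fin n → Side → Fin (suc (n + n)) × Fin (suc (n + n))
  triangleEdge i s = corner i (proj₁ (ends s)) , corner i (proj₂ (ends s))

  -- friendshipEdges n is by definition blocks id, so positions address the vertices of L(Fₙ).
  open Blocks triangleEdge

  G : Graph
  G = lineFriendship n

  Vertex : Set
  Vertex = Fin (V G)

  edge : Fin n → Side → Vertex
  edge = position id

  ↑ˡ≢↑ʳ : ∀ (i j : Fin n) → i ↑ˡ n ≢ n ↑ʳ j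
  ↑ˡ≢↑ʳ i j e with () ← trans (sym (splitAt-↑ˡ n i n)) (trans (cong (splitAt n) e) (splitAt-↑ʳ n n j))

  corner-== : ∀ i j c d → (corner i c == corner j d) ≡ sameCorner (i == j) c d
  corner-== i j centre centre = refl
  corner-== i j centre outerˡ = refl
  corner-== i j centre outerʳ = refl
  corner-== i j outerˡ centre = refl
  corner-== i j outerʳ centre = refl
  corner-== i j outerˡ outerˡ = ==-injective (↑ˡ-injective n _ _ ∘ suc-injective) i j
  corner-== i j outerʳ outerʳ = ==-injective (↑ʳ-injective n _ _ ∘ suc-injective) i j
  corner-== i j outerˡ outerʳ = ==-≢ (↑ˡ≢↑ʳ i j ∘ suc-injective)
  corner-== i j outerʳ outerˡ = ==-≢ (↑ˡ≢↑ʳ j i ∘ sym ∘ suc-injective)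

  adj-edge : ∀ i s j t → adj G (edge i s) (edge j t) ≡ adjᴸ (i == j) s t
  adj-edge i s j t rewrite lookup-position id i s | lookup-position id j t | position-== id i s j t
    | corner-== i j (proj₁ (ends s)) (proj₁ (ends t)) | corner-== i j (proj₁ (ends s)) (proj₂ (ends t))
    | corner-== i j (proj₂ (ends s)) (proj₁ (ends t)) | corner-== i j (proj₂ (ends s)) (proj₂ (ends t)) = refl

  triangleNbrs : Side → Bool → ℕ
  triangleNbrs rim same = if same then 2 else 0
  triangleNbrs _   _    = 2

  countSide-adjᴸ : ∀ s same → countSide (adjᴸ same s) ≡ triangleNbrs s same
  countSide-adjᴸ spokeˡ true  = refl
  countSide-adjᴸ spokeˡ false = refl
  countSide-adjᴸ spokeʳ true  = refl
  countSide-adjᴸ spokeʳ false = refl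
  countSide-adjᴸ rim    true  = refl
  countSide-adjᴸ rim    false = refl

  degᴸ : Side → ℕ
  degᴸ rim = 2
  degᴸ _   = n + n

  deg-edge : ∀ i s → deg G (edge i s) ≡ degᴸ s
  deg-edge i s = begin
    deg G (edge i s)                                    ≡⟨ countF-blocks id (adj G (edge i s)) ⟩
    sumF (λ j → countSide (adj G (edge i s) ∘ edge j))  ≡⟨ sumF-cong triangle-count ⟩
    sumF (λ j → triangleNbrs s (i == j))                ≡⟨ sum-over-triangles s ⟩
    degᴸ s                                              ∎
    where
    open ≡-Reasoning
    triangle-count : ∀ j → countSide (adj G (edge i s) ∘ edge j) ≡ triangleNbrs s (i == j)
    triangle-count j rewrite adj-edge i s j spokeˡ | adj-edge i s j spokeʳ | adj-edge i s j rim =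
      countSide-adjᴸ s (i == j)
    sum-of-twos : sumF {n} (λ _ → 2) ≡ n + n
    sum-of-twos = trans (sumF-const n 2) (trans (*-comm n 2) (cong (n +_) (+-identityʳ n)))
    sum-over-triangles : ∀ s → sumF (λ j → triangleNbrs s (i == j)) ≡ degᴸ s
    sum-over-triangles spokeˡ = sum-of-twos
    sum-over-triangles spokeʳ = sum-of-twos
    sum-over-triangles rim    = sumF-δ i 2

  0<n : Fin n → 0 < n
  0<n z = ≤-<-trans z≤n (Finₚ.toℕ<n z)

  maxDeg≡n+n : Fin n → maxDeg G ≡ n + n
  maxDeg≡n+n z = maxF-attained (deg G) (edge z spokeˡ)
    (position-induction id _ λ i s → ≤-trans (≤-reflexive (deg-edge i s)) (degᴸ≤n+n s))
    (deg-edge z spokeˡ)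
    where
    degᴸ≤n+n : ∀ s → degᴸ s ≤ n + n
    degᴸ≤n+n spokeˡ = ≤-refl
    degᴸ≤n+n spokeʳ = ≤-refl
    degᴸ≤n+n rim    = +-mono-≤ (0<n z) (0<n z)

  ↑-induction : (P : Fin (n + n) → Set) → (∀ i → P (i ↑ˡ n)) → (∀ i → P (n ↑ʳ i)) → ∀ x → P x
  ↑-induction P left right x = subst P (join-splitAt n n x) ([_,_] {C = P ∘ join n n} left right (splitAt n x))

  spoke : Fin (n + n) → Vertex
  spoke x = [ (λ i → edge i spokeˡ) , (λ i → edge i spokeʳ) ]′ (splitAt n x)

  spoke-↑ˡ : ∀ i → spoke (i ↑ˡ n) ≡ edge i spokeˡ
  spoke-↑ˡ i rewrite splitAt-↑ˡ n i n = refl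

  spoke-↑ʳ : ∀ i → spoke (n ↑ʳ i) ≡ edge i spokeʳ
  spoke-↑ʳ i rewrite splitAt-↑ʳ n n i = refl

  spokes-adjacent : ∀ x y → x ≢ y → adj G (spoke x) (spoke y) ≡ true
  spokes-adjacent = ↑-induction _ (λ i → ↑-induction _ (ˡˡ i) (ˡʳ i)) (λ i → ↑-induction _ (ʳˡ i) (ʳʳ i))
    where
    ˡˡ : ∀ i j → i ↑ˡ n ≢ j ↑ˡ n → adj G (spoke (i ↑ˡ n)) (spoke (j ↑ˡ n)) ≡ true
    ˡˡ i j i≢j rewrite spoke-↑ˡ i | spoke-↑ˡ j | adj-edge i spokeˡ j spokeˡ | ==-≢ (i≢j ∘ cong (_↑ˡ n)) = refl
    ˡʳ : ∀ i j → i ↑ˡ n ≢ n ↑ʳ j → adj G (spoke (i ↑ˡ n)) (spoke (n ↑ʳ j)) ≡ true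
    ˡʳ i j _ rewrite spoke-↑ˡ i | spoke-↑ʳ j | adj-edge i spokeˡ j spokeʳ = refl
    ʳˡ : ∀ i j → n ↑ʳ i ≢ j ↑ˡ n → adj G (spoke (n ↑ʳ i)) (spoke (j ↑ˡ n)) ≡ true
    ʳˡ i j _ rewrite spoke-↑ʳ i | spoke-↑ˡ j | adj-edge i spokeʳ j spokeˡ = refl
    ʳʳ : ∀ i j → n ↑ʳ i ≢ n ↑ʳ j → adj G (spoke (n ↑ʳ i)) (spoke (n ↑ʳ j)) ≡ true
    ʳʳ i j i≢j rewrite spoke-↑ʳ i | spoke-↑ʳ j | adj-edge i spokeʳ j spokeʳ | ==-≢ (i≢j ∘ cong (n ↑ʳ_)) = refl

  spoke-adj-rim : ∀ x → ∃ λ i → adj G (spoke x) (edge i rim) ≡ true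
  spoke-adj-rim = ↑-induction _ (λ i → i , ˡ i) (λ i → i , ʳ i)
    where
    ˡ : ∀ i → adj G (spoke (i ↑ˡ n)) (edge i rim) ≡ true
    ˡ i rewrite spoke-↑ˡ i | adj-edge i spokeˡ i rim | ==-refl i = refl
    ʳ : ∀ i → adj G (spoke (n ↑ʳ i)) (edge i rim) ≡ true
    ʳ i rewrite spoke-↑ʳ i | adj-edge i spokeʳ i rim | ==-refl i = refl

  spoke-rim-induction : (P : Vertex → Set) → (∀ x → P (spoke x)) → (∀ i → P (edge i rim)) → ∀ v → P v
  spoke-rim-induction P on-spoke on-rim = position-induction id P on-edge
    where
    on-edge : ∀ i s → P (edge i s)
    on-edge i spokeˡ = subst P (spoke-↑ˡ i) (on-spoke (i ↑ˡ n))
    on-edge i spokeʳ = subst P (spoke-↑ʳ i) (on-spoke (n ↑ʳ i))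
    on-edge i rim    = on-rim i

  rim-adj-spoke : ∀ i s → s ≢ rim → adj G (edge i rim) (edge i s) ≡ true
  rim-adj-spoke i spokeˡ _ rewrite adj-edge i rim i spokeˡ | ==-refl i = refl
  rim-adj-spoke i spokeʳ _ rewrite adj-edge i rim i spokeʳ | ==-refl i = refl
  rim-adj-spoke i rim s≢rim = contradiction refl s≢rim

  module SpokeRimColouring {k} (g : Fin (n + n) → Fin k) (g-injective : ∀ {x y} → g x ≡ g y → x ≡ y)
                (rimColour : Fin n → Fin k)
                (rim-fresh : ∀ i → rimColour i ≢ g (i ↑ˡ n) × rimColour i ≢ g (n ↑ʳ i)) where

    colourᴸ : Fin n → Side → Fin k
    colourᴸ i spokeˡ = g (i ↑ˡ n)
    colourᴸ i spokeʳ = g (n ↑ʳ i)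
    colourᴸ i rim    = rimColour i

    colour : Vertex → Fin k
    colour = uncurry colourᴸ ∘ locate id

    colour-edge : ∀ i s → colour (edge i s) ≡ colourᴸ i s
    colour-edge i s rewrite locate-position id i s = refl

    colour-spoke : ∀ x → colour (spoke x) ≡ g x
    colour-spoke = ↑-induction _
      (λ i → trans (cong colour (spoke-↑ˡ i)) (colour-edge i spokeˡ))
      (λ i → trans (cong colour (spoke-↑ʳ i)) (colour-edge i spokeʳ))

    properᴸ : ∀ i s j t → adjᴸ (i == j) s t ≡ true → colourᴸ i s ≢ colourᴸ j t
    properᴸ i s j t h e with i ≟ j
    properᴸ i spokeˡ .i spokeˡ () _ | yes refl
    properᴸ i spokeʳ .i spokeʳ () _ | yes refl
    properᴸ i rim    .i rim    () _ | yes refl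
    properᴸ i spokeˡ .i spokeʳ _  e | yes refl = ↑ˡ≢↑ʳ i i (g-injective e)
    properᴸ i spokeʳ .i spokeˡ _  e | yes refl = ↑ˡ≢↑ʳ i i (sym (g-injective e))
    properᴸ i spokeˡ .i rim    _  e | yes refl = proj₁ (rim-fresh i) (sym e)
    properᴸ i spokeʳ .i rim    _  e | yes refl = proj₂ (rim-fresh i) (sym e)
    properᴸ i rim    .i spokeˡ _  e | yes refl = proj₁ (rim-fresh i) e
    properᴸ i rim    .i spokeʳ _  e | yes refl = proj₂ (rim-fresh i) e
    properᴸ i spokeˡ j spokeˡ _  e | no i≢j = i≢j (↑ˡ-injective n i j (g-injective e))
    properᴸ i spokeʳ j spokeʳ _  e | no i≢j = i≢j (↑ʳ-injective n i j (g-injective e))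
    properᴸ i spokeˡ j spokeʳ _  e | no _   = ↑ˡ≢↑ʳ i j (g-injective e)
    properᴸ i spokeʳ j spokeˡ _  e | no _   = ↑ˡ≢↑ʳ j i (sym (g-injective e))
    properᴸ i spokeˡ j rim    () _ | no _
    properᴸ i spokeʳ j rim    () _ | no _
    properᴸ i rim    j spokeˡ () _ | no _
    properᴸ i rim    j spokeʳ () _ | no _
    properᴸ i rim    j rim    () _ | no _

    proper : Proper G colour
    proper = position-induction id _ λ i s → position-induction id _ λ j t h e →
      properᴸ i s j t (trans (sym (adj-edge i s j t)) h) (trans (sym (colour-edge i s)) (trans e (colour-edge j t)))

    spoke-sees-spoke : ∀ x y → x ≢ y → NbrColour G colour (spoke x) (g y)
    spoke-sees-spoke x y x≢y = spoke y , spokes-adjacent x y x≢y , colour-spoke y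

    spoke-sees-rim : ∀ x → ∃ λ i → NbrColour G colour (spoke x) (rimColour i)
    spoke-sees-rim x = let i , x~rim = spoke-adj-rim x in i , edge i rim , x~rim , colour-edge i rim

    rim-sees-two : ∀ i → 2 ≤ nbrColours G colour (edge i rim)
    rim-sees-two i = 2≤nbrColours G colour (↑ˡ≢↑ʳ i i ∘ g-injective)
      (edge i spokeˡ , rim-adj-spoke i spokeˡ (λ ()) , colour-edge i spokeˡ)
      (edge i spokeʳ , rim-adj-spoke i spokeʳ (λ ()) , colour-edge i spokeʳ)

    rim-cond : ∀ r i → deg G (edge i rim) ⊓ r ≤ nbrColours G colour (edge i rim)
    rim-cond r i = ≤-trans (m⊓n≤m _ r) (≤-trans (≤-reflexive (deg-edge i rim)) (rim-sees-two i))

  colouring-below-Δ : (other : Fin n → Fin n) → (∀ i → other i ≢ i)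
    → ∀ {r} → 0 < r → r ≤ maxDeg G → r < n + n → CondColouring G (n + n) r
  colouring-below-Δ other other≢ {r} 0<r r≤Δ r<n+n = record
    { k-pos = <-trans 0<r r<n+n ; r-pos = 0<r ; r≤Δ = r≤Δ ; r≤k = <⇒≤ r<n+n
    ; colour = colour ; surj = λ x → spoke x , colour-spoke x ; proper = proper
    ; cond = spoke-rim-induction _ spoke-cond (rim-cond r) }
    where
    open SpokeRimColouring id id (λ i → other i ↑ˡ n) (λ i → other≢ i ∘ ↑ˡ-injective n _ _ , ↑ˡ≢↑ʳ (other i) i)
    spoke-cond : ∀ x → deg G (spoke x) ⊓ r ≤ nbrColours G colour (spoke x)
    spoke-cond x = ≤-trans (m⊓n≤n _ r) (≤-pred (≤-trans r<n+n (k≤1+nbrColours G colour (spoke x) sees-others)))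
      where
      sees-others : ∀ y → y ≢ colour (spoke x) → NbrColour G colour (spoke x) y
      sees-others y y≢x = spoke-sees-spoke x y (λ x≡y → y≢x (trans (sym x≡y) (sym (colour-spoke x))))

  colouring-at-Δ : Fin n → CondColouring G (suc (n + n)) (n + n)
  colouring-at-Δ z = record
    { k-pos = z<s ; r-pos = ≤-trans (0<n z) (m≤m+n n n) ; r≤Δ = ≤-reflexive (sym (maxDeg≡n+n z)) ; r≤k = n≤1+n _
    ; colour = colour ; surj = surj ; proper = proper
    ; cond = spoke-rim-induction _ spoke-cond (rim-cond (n + n)) }
    where
    open SpokeRimColouring suc suc-injective (λ _ → zero) (λ _ → (λ ()) , (λ ()))
    surj : ∀ y → ∃ λ v → colour v ≡ y
    surj zero    = edge z rim , colour-edge z rim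
    surj (suc x) = spoke x , colour-spoke x
    spoke-cond : ∀ x → deg G (spoke x) ⊓ (n + n) ≤ nbrColours G colour (spoke x)
    spoke-cond x = ≤-trans (m⊓n≤n _ _) (≤-pred (k≤1+nbrColours G colour (spoke x) sees-others))
      where
      sees-others : ∀ y → y ≢ colour (spoke x) → NbrColour G colour (spoke x) y
      sees-others zero    _   = proj₂ (spoke-sees-rim x)
      sees-others (suc y) y≢x = spoke-sees-spoke x y (λ x≡y → y≢x (trans (cong suc (sym x≡y)) (sym (colour-spoke x))))

  n+n≤colours : ∀ {k r} → CondColouring G k r → n + n ≤ k
  n+n≤colours C = clique-size≤k G colour proper spoke spokes-adjacent
    where open CondColouring C

  n+n<colours : Fin n → ∀ {k} → CondColouring G k (n + n) → n + n < k
  n+n<colours z C = subst (_< _) (trans (cong (_⊓ (n + n)) (deg-edge z spokeˡ)) (⊓-idem (n + n)))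
    (deg⊓r<k C (edge z spokeˡ))

another : ∀ {m} → Fin (suc (suc m)) → Fin (suc (suc m))
another zero    = suc zero
another (suc _) = zero

another-≢ : ∀ {m} (i : Fin (suc (suc m))) → another i ≢ i
another-≢ zero    ()
another-≢ (suc _) ()

proposition3p5 : (n r : ℕ) → 2 ≤ n → 0 < r → r ≤ maxDeg (lineFriendship n)
    → (r < maxDeg (lineFriendship n) → IsChiR (lineFriendship n) r (n + n))
      × (r ≡ maxDeg (lineFriendship n) → IsChiR (lineFriendship n) r (suc (n + n)))
proposition3p5 n@(suc (suc _)) r (s≤s (s≤s z≤n)) 0<r r≤Δ = below-Δ , at-Δ
  where
  open LineFriendship n
  Δ≡n+n : maxDeg G ≡ n + n
  Δ≡n+n = maxDeg≡n+n zero

  below-Δ : r < maxDeg G → IsChiR G r (n + n)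
  below-Δ r<Δ = colouring-below-Δ another another-≢ 0<r r≤Δ (subst (r <_) Δ≡n+n r<Δ)
              , λ k k<n+n C → <⇒≱ k<n+n (n+n≤colours C)

  at-Δ : r ≡ maxDeg G → IsChiR G r (suc (n + n))
  at-Δ r≡Δ = subst (λ r → IsChiR G r (suc (n + n))) (sym (trans r≡Δ Δ≡n+n))
    (colouring-at-Δ zero , λ k k<1+n+n C → <⇒≱ (n+n<colours zero C) (≤-pred k<1+n+n))
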